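{- In $\mathbf{IPF}^I$, for all formulas $F,G$ and distinct variables $x,y$ (with $y$ not occurring in $F$, $G$): $Ix[F,G],\ Ix[F,\exists!x]\vdash\exists x(F\land\forall y(F^x_y\rightarrow y=x)\land G)$.
   Context: $\mathbf{IPF}$ is a natural deduction system of intuitionist positive free logic: a first-order language without function symbols, terms constants and parameters, primitive predicate $\exists!$ ("exists"), identity; standard intuitionist rules for $\land,\rightarrow,\lor,\leftrightarrow$, $\bot E$ to atomic conclusions; $\forall I$ (infer $\forall xA$ from a deduction of $A^x_a$, discharging $\exists!a$, $a$ fresh), $\forall E$ (from $\forall xA$, $\exists!t$ infer $A^x_t$), $\exists I$ (from $A^x_t$, $\exists!t$ infer $\exists xA$), $\exists E$ (from $\exists xA$ and a deduction of $C$ from $A^x_a,\exists!a$ infer $C$, discharging them, $a$ fresh); $=I$: axiom $t=t$; $=E$: from $t_1=t_2$ and $A^x_{t_1}$ infer $A^x_{t_2}$ ($A$ atomic). $\mathbf{IPF}^I$ adds formulas $Ix[F,G]$ ("the $F$ is $G$", binding $x$) with rules ($a,b$ fresh parameters not occurring in $F,G,C$ or other open assumptions of the subdeduction, $a\neq t$): $II$: from $F^x_t,G^x_t,\exists!t$ and a deduction of $a=t$ from $F^x_a,\exists!a$ (discharged) infer $Ix[F,G]$; $IE^{1p}$: from $Ix[F,G]$, $F^x_t$, $\exists!t$, a deduction of $a=t$ from $F^x_a,\exists!a$ and a deduction of $C$ from $F^x_b,G^x_b,\exists!b$ (all discharged) infer $C$; $IE^{2p}$: from $Ix[F,\exists!x],\exists!t_1,\exists!t_2,F^x_{t_1},F^x_{t_2},A^x_{t_1}$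 infer $A^x_{t_2}$ ($A$ atomic); $IE^{3p}$: from $Ix[F,\exists!x]$ and a deduction of $C$ from $F^x_a,\exists!a$ (discharged) infer $C$; $IE^{4p}$: from $Ix[F,x=t_2],\exists!t_1,\exists!t_2,F^x_{t_1},A^x_{t_1}$ infer $A^x_{t_2}$ ($A$ atomic); $IE^{5p}$: from $Ix[F,x=t],\exists!t$ and a deduction of $C$ from $F^x_a,\exists!a$ (discharged) infer $C$. -}

module Defs where

open import Data.Nat using (ℕ; _≟_)
open import Data.List using (List; []; _∷_; _++_; map; concatMap)
open import Data.List.Membership.Propositional using (_∈_; _∉_)
open import Relation.Nullary using (yes; no)

Var : Set
Var = ℕ

Par : Set
Par = ℕ

Con : Set
Con = ℕ

Pred : Set
Pred = ℕ

-- Closed terms: constants and parameters (the terms of the language).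
data CTerm : Set where
  par : Par → CTerm
  con : Con → CTerm

-- Term positions in formulas may also hold (bound) variables.
data Term : Set where
  var  : Var → Term
  ctm  : CTerm → Term

⌜_⌝ : CTerm → Term
⌜ t ⌝ = ctm t

infix  7 _≐_
infixr 6 _∧'_
infixr 5 _∨'_
infixr 4 _⇒_ _⇔_

data Formula : Set where
  pr   : Pred → List Term → Formula
  E!   : Term → Formula
  _≐_  : Term → Term → Formula
  ⊥'   : Formula
  _∧'_ : Formula → Formula → Formula
  _∨'_ : Formula → Formula → Formula
  _⇒_  : Formula → Formula → Formula
  _⇔_  : Formula → Formula → Formula
  ∀'   : Var → Formula → Formula
  ∃'   : Var → Formula → Formula
  I    : Var → Formula → Formula → Formula

data Atomic : Formula → Set where
  at-pr : ∀ P ts → Atomic (pr P ts)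
  at-E! : ∀ t → Atomic (E! t)
  at-≐  : ∀ t u → Atomic (t ≐ u)

substT : Var → Term → Term → Term
substT x s (var z) with x ≟ z
... | yes _ = s
... | no  _ = var z
substT x s (ctm c) = ctm c

infix 8 _[_≔_]

_[_≔_] : Formula → Var → Term → Formula
pr P ts  [ x ≔ s ] = pr P (map (substT x s) ts)
E! t     [ x ≔ s ] = E! (substT x s t)
(t ≐ u)  [ x ≔ s ] = substT x s t ≐ substT x s u
⊥'       [ x ≔ s ] = ⊥'
(A ∧' B) [ x ≔ s ] = A [ x ≔ s ] ∧' B [ x ≔ s ]
(A ∨' B) [ x ≔ s ] = A [ x ≔ s ] ∨' B [ x ≔ s ]
(A ⇒ B)  [ x ≔ s ] = A [ x ≔ s ] ⇒ B [ x ≔ s ]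
(A ⇔ B)  [ x ≔ s ] = A [ x ≔ s ] ⇔ B [ x ≔ s ]
∀' z A   [ x ≔ s ] with x ≟ z
... | yes _ = ∀' z A
... | no  _ = ∀' z (A [ x ≔ s ])
∃' z A   [ x ≔ s ] with x ≟ z
... | yes _ = ∃' z A
... | no  _ = ∃' z (A [ x ≔ s ])
I z F G  [ x ≔ s ] with x ≟ z
... | yes _ = I z F G
... | no  _ = I z (F [ x ≔ s ]) (G [ x ≔ s ])

parsT : Term → List Par
parsT (ctm (par a)) = a ∷ []
parsT _             = []

parsF : Formula → List Par
parsF (pr P ts) = concatMap parsT ts
parsF (E! t)    = parsT t
parsF (t ≐ u)   = parsT t ++ parsT u
parsF ⊥'        = []
parsF (A ∧' B)  = parsF A ++ parsF B
parsF (A ∨' B)  = parsF A ++ parsF B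
parsF (A ⇒ B)   = parsF A ++ parsF B
parsF (A ⇔ B)   = parsF A ++ parsF B
parsF (∀' z A)  = parsF A
parsF (∃' z A)  = parsF A
parsF (I z F G) = parsF F ++ parsF G

parsL : List Formula → List Par
parsL = concatMap parsF

varsT : Term → List Var
varsT (var z) = z ∷ []
varsT (ctm _) = []

varsF : Formula → List Var
varsF (pr P ts) = concatMap varsT ts
varsF (E! t)    = varsT t
varsF (t ≐ u)   = varsT t ++ varsT u
varsF ⊥'        = []
varsF (A ∧' B)  = varsF A ++ varsF B
varsF (A ∨' B)  = varsF A ++ varsF B
varsF (A ⇒ B)   = varsF A ++ varsF B
varsF (A ⇔ B)   = varsF A ++ varsF B
varsF (∀' z A)  = z ∷ varsF A
varsF (∃' z A)  = z ∷ varsF A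
varsF (I z F G) = z ∷ varsF F ++ varsF G

-- Natural deduction in sequent style: Γ ⊢ A means A is deducible from the
-- open assumptions Γ.
infix 2 _⊢_

data _⊢_ (Γ : List Formula) : Formula → Set where
  hyp  : ∀ {A} → A ∈ Γ → Γ ⊢ A
  ∧I   : ∀ {A B} → Γ ⊢ A → Γ ⊢ B → Γ ⊢ A ∧' B
  ∧E₁  : ∀ {A B} → Γ ⊢ A ∧' B → Γ ⊢ A
  ∧E₂  : ∀ {A B} → Γ ⊢ A ∧' B → Γ ⊢ B
  ⇒I   : ∀ {A B} → A ∷ Γ ⊢ B → Γ ⊢ A ⇒ B
  ⇒E   : ∀ {A B} → Γ ⊢ A ⇒ B → Γ ⊢ A → Γ ⊢ B
  ∨I₁  : ∀ {A B} → Γ ⊢ A → Γ ⊢ A ∨' B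
  ∨I₂  : ∀ {A B} → Γ ⊢ B → Γ ⊢ A ∨' B
  ∨E   : ∀ {A B C} → Γ ⊢ A ∨' B → A ∷ Γ ⊢ C → B ∷ Γ ⊢ C → Γ ⊢ C
  ⇔I   : ∀ {A B} → A ∷ Γ ⊢ B → B ∷ Γ ⊢ A → Γ ⊢ A ⇔ B
  ⇔E₁  : ∀ {A B} → Γ ⊢ A ⇔ B → Γ ⊢ A → Γ ⊢ B
  ⇔E₂  : ∀ {A B} → Γ ⊢ A ⇔ B → Γ ⊢ B → Γ ⊢ A
  ⊥E   : ∀ {A} → Atomic A → Γ ⊢ ⊥' → Γ ⊢ A
  ∀I   : ∀ {x A} (a : Par) → a ∉ parsL Γ → a ∉ parsF (∀' x A) →
         E! ⌜ par a ⌝ ∷ Γ ⊢ A [ x ≔ ⌜ par a ⌝ ] → Γ ⊢ ∀' x A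
  ∀E   : ∀ {x A} (t : CTerm) → Γ ⊢ ∀' x A → Γ ⊢ E! ⌜ t ⌝ → Γ ⊢ A [ x ≔ ⌜ t ⌝ ]
  ∃I   : ∀ {x A} (t : CTerm) → Γ ⊢ A [ x ≔ ⌜ t ⌝ ] → Γ ⊢ E! ⌜ t ⌝ → Γ ⊢ ∃' x A
  ∃E   : ∀ {x A C} (a : Par) → Γ ⊢ ∃' x A →
         a ∉ parsL Γ → a ∉ parsF (∃' x A) → a ∉ parsF C →
         A [ x ≔ ⌜ par a ⌝ ] ∷ E! ⌜ par a ⌝ ∷ Γ ⊢ C → Γ ⊢ C
  =I   : (t : CTerm) → Γ ⊢ ⌜ t ⌝ ≐ ⌜ t ⌝
  =E   : ∀ {x A} (t₁ t₂ : CTerm) → Atomic A → Γ ⊢ ⌜ t₁ ⌝ ≐ ⌜ t₂ ⌝ →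
         Γ ⊢ A [ x ≔ ⌜ t₁ ⌝ ] → Γ ⊢ A [ x ≔ ⌜ t₂ ⌝ ]
  II   : ∀ {x F G} (t : CTerm) (a : Par) →
         Γ ⊢ F [ x ≔ ⌜ t ⌝ ] → Γ ⊢ G [ x ≔ ⌜ t ⌝ ] → Γ ⊢ E! ⌜ t ⌝ →
         a ∉ parsL Γ → a ∉ parsF F → a ∉ parsF G → a ∉ parsT ⌜ t ⌝ →
         F [ x ≔ ⌜ par a ⌝ ] ∷ E! ⌜ par a ⌝ ∷ Γ ⊢ ⌜ par a ⌝ ≐ ⌜ t ⌝ →
         Γ ⊢ I x F G
  IE1p : ∀ {x F G C} (t : CTerm) (a b : Par) →
         Γ ⊢ I x F G → Γ ⊢ F [ x ≔ ⌜ t ⌝ ] → Γ ⊢ E! ⌜ t ⌝ →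
         a ∉ parsL Γ → a ∉ parsF F → a ∉ parsF G → a ∉ parsF C → a ∉ parsT ⌜ t ⌝ →
         F [ x ≔ ⌜ par a ⌝ ] ∷ E! ⌜ par a ⌝ ∷ Γ ⊢ ⌜ par a ⌝ ≐ ⌜ t ⌝ →
         b ∉ parsL Γ → b ∉ parsF F → b ∉ parsF G → b ∉ parsF C →
         F [ x ≔ ⌜ par b ⌝ ] ∷ G [ x ≔ ⌜ par b ⌝ ] ∷ E! ⌜ par b ⌝ ∷ Γ ⊢ C →
         Γ ⊢ C
  IE2p : ∀ {x F A} (t₁ t₂ : CTerm) → Atomic A →
         Γ ⊢ I x F (E! (var x)) → Γ ⊢ E! ⌜ t₁ ⌝ → Γ ⊢ E! ⌜ t₂ ⌝ →
         Γ ⊢ F [ x ≔ ⌜ t₁ ⌝ ] → Γ ⊢ F [ x ≔ ⌜ t₂ ⌝ ] →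
         Γ ⊢ A [ x ≔ ⌜ t₁ ⌝ ] → Γ ⊢ A [ x ≔ ⌜ t₂ ⌝ ]
  IE3p : ∀ {x F C} (a : Par) →
         Γ ⊢ I x F (E! (var x)) →
         a ∉ parsL Γ → a ∉ parsF F → a ∉ parsF C →
         F [ x ≔ ⌜ par a ⌝ ] ∷ E! ⌜ par a ⌝ ∷ Γ ⊢ C → Γ ⊢ C
  IE4p : ∀ {x F A} (t₁ t₂ : CTerm) → Atomic A →
         Γ ⊢ I x F (var x ≐ ⌜ t₂ ⌝) → Γ ⊢ E! ⌜ t₁ ⌝ → Γ ⊢ E! ⌜ t₂ ⌝ →
         Γ ⊢ F [ x ≔ ⌜ t₁ ⌝ ] → Γ ⊢ A [ x ≔ ⌜ t₁ ⌝ ] → Γ ⊢ A [ x ≔ ⌜ t₂ ⌝ ]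
  IE5p : ∀ {x F C} (t : CTerm) (a : Par) →
         Γ ⊢ I x F (var x ≐ ⌜ t ⌝) → Γ ⊢ E! ⌜ t ⌝ →
         a ∉ parsL Γ → a ∉ parsF F → a ∉ parsF C → a ∉ parsT ⌜ t ⌝ →
         F [ x ≔ ⌜ par a ⌝ ] ∷ E! ⌜ par a ⌝ ∷ Γ ⊢ C → Γ ⊢ C

-- Ix[F,∃!x] makes any two existing F's equal (IE2p applied to the atom s = x). IE3p on it yields
-- an existing a with F(a), which is therefore the unique F; IE1p on Ix[F,G] at a then yields an
-- existing b with F(b) and G(b), uniqueness again gives ∀y(F(y) → y = b), and b witnesses the
-- existential. Fresh parameters are chosen above every parameter occurring in F and G.

module Submission where

open import Defs
open import Data.List using (List; []; _∷_; _++_; map; concatMap)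
open import Data.List.Extrema.Nat using (max; xs≤max)
open import Data.List.Membership.Propositional using (_∈_; _∉_)
open import Data.List.Membership.Propositional.Properties using (∈-++⁺ˡ; ∈-++⁺ʳ)
open import Data.List.Relation.Unary.All as All using (All; []; _∷_)
open import Data.List.Relation.Unary.All.Properties using (++⁺; ++⁻ˡ; ++⁻ʳ)
open import Data.List.Relation.Unary.Any using (here; there)
open import Data.Nat using (ℕ; suc; _<_; _≟_; s≤s)
open import Data.Nat.Properties using (<-irrefl; m<n⇒m<1+n; n<1+n)
open import Relation.Nullary using (yes; no; contradiction)
open import Relation.Binary.PropositionalEquality
  using (_≡_; _≢_; refl; sym; trans; cong; cong₂; subst; module ≡-Reasoning)

∉-++⁻ˡ : ∀ {A : Set} {y : A} {xs ys} → y ∉ xs ++ ys → y ∉ xs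
∉-++⁻ˡ y∉ y∈ = y∉ (∈-++⁺ˡ y∈)

∉-++⁻ʳ : ∀ {A : Set} {y : A} xs {ys} → y ∉ xs ++ ys → y ∉ ys
∉-++⁻ʳ xs y∉ y∈ = y∉ (∈-++⁺ʳ xs y∈)

∉-head : ∀ {A : Set} {y z : A} {zs} → y ∉ z ∷ zs → y ≢ z
∉-head y∉ y≡z = y∉ (here y≡z)

∉-tail : ∀ {A : Set} {y z : A} {zs} → y ∉ z ∷ zs → y ∉ zs
∉-tail y∉ y∈ = y∉ (there y∈)

substT-self : ∀ x s → substT x s (var x) ≡ s
substT-self x s with x ≟ x
... | yes _  = refl
... | no x≢x = contradiction refl x≢x

substT-other : ∀ {x z} s → x ≢ z → substT x s (var z) ≡ var z
substT-other {x} {z} s x≢z with x ≟ z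
... | yes x≡z = contradiction x≡z x≢z
... | no _    = refl

∀-[≔]-bound : ∀ x A s → (∀' x A) [ x ≔ s ] ≡ ∀' x A
∀-[≔]-bound x A s with x ≟ x
... | yes _  = refl
... | no x≢x = contradiction refl x≢x

∃-[≔]-bound : ∀ x A s → (∃' x A) [ x ≔ s ] ≡ ∃' x A
∃-[≔]-bound x A s with x ≟ x
... | yes _  = refl
... | no x≢x = contradiction refl x≢x

I-[≔]-bound : ∀ x A B s → (I x A B) [ x ≔ s ] ≡ I x A B
I-[≔]-bound x A B s with x ≟ x
... | yes _  = refl
... | no x≢x = contradiction refl x≢x

∀-[≔]-other : ∀ {x z} A s → x ≢ z → (∀' z A) [ x ≔ s ] ≡ ∀' z (A [ x ≔ s ])
∀-[≔]-other {x} {z} A s x≢z with x ≟ z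
... | yes x≡z = contradiction x≡z x≢z
... | no _    = refl

∃-[≔]-other : ∀ {x z} A s → x ≢ z → (∃' z A) [ x ≔ s ] ≡ ∃' z (A [ x ≔ s ])
∃-[≔]-other {x} {z} A s x≢z with x ≟ z
... | yes x≡z = contradiction x≡z x≢z
... | no _    = refl

I-[≔]-other : ∀ {x z} A B s → x ≢ z → (I z A B) [ x ≔ s ] ≡ I z (A [ x ≔ s ]) (B [ x ≔ s ])
I-[≔]-other {x} {z} A B s x≢z with x ≟ z
... | yes x≡z = contradiction x≡z x≢z
... | no _    = refl

substT-fresh : ∀ y s t → y ∉ varsT t → substT y s t ≡ t
substT-fresh y s (var z) y∉ = substT-other s (∉-head y∉)
substT-fresh y s (ctm c) y∉ = refl

map-substT-fresh : ∀ y s ts → y ∉ concatMap varsT ts → map (substT y s) ts ≡ ts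
map-substT-fresh y s []       y∉ = refl
map-substT-fresh y s (t ∷ ts) y∉ =
  cong₂ _∷_ (substT-fresh y s t (∉-++⁻ˡ y∉)) (map-substT-fresh y s ts (∉-++⁻ʳ (varsT t) y∉))

[≔]-fresh : ∀ y s A → y ∉ varsF A → A [ y ≔ s ] ≡ A
[≔]-fresh y s (pr P ts) y∉ = cong (pr P) (map-substT-fresh y s ts y∉)
[≔]-fresh y s (E! t)    y∉ = cong E! (substT-fresh y s t y∉)
[≔]-fresh y s (t ≐ u)   y∉ =
  cong₂ _≐_ (substT-fresh y s t (∉-++⁻ˡ y∉)) (substT-fresh y s u (∉-++⁻ʳ (varsT t) y∉))
[≔]-fresh y s ⊥'        y∉ = refl
[≔]-fresh y s (A ∧' B)  y∉ = cong₂ _∧'_ ([≔]-fresh y s A (∉-++⁻ˡ y∉)) ([≔]-fresh y s B (∉-++⁻ʳ (varsF A) y∉))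
[≔]-fresh y s (A ∨' B)  y∉ = cong₂ _∨'_ ([≔]-fresh y s A (∉-++⁻ˡ y∉)) ([≔]-fresh y s B (∉-++⁻ʳ (varsF A) y∉))
[≔]-fresh y s (A ⇒ B)   y∉ = cong₂ _⇒_ ([≔]-fresh y s A (∉-++⁻ˡ y∉)) ([≔]-fresh y s B (∉-++⁻ʳ (varsF A) y∉))
[≔]-fresh y s (A ⇔ B)   y∉ = cong₂ _⇔_ ([≔]-fresh y s A (∉-++⁻ˡ y∉)) ([≔]-fresh y s B (∉-++⁻ʳ (varsF A) y∉))
[≔]-fresh y s (∀' z A)  y∉ =
  trans (∀-[≔]-other A s (∉-head y∉)) (cong (∀' z) ([≔]-fresh y s A (∉-tail y∉)))
[≔]-fresh y s (∃' z A)  y∉ =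
  trans (∃-[≔]-other A s (∉-head y∉)) (cong (∃' z) ([≔]-fresh y s A (∉-tail y∉)))
[≔]-fresh y s (I z A B) y∉ =
  trans (I-[≔]-other A B s (∉-head y∉))
        (cong₂ (I z) ([≔]-fresh y s A (∉-++⁻ˡ (∉-tail y∉)))
                     ([≔]-fresh y s B (∉-++⁻ʳ (varsF A) (∉-tail y∉))))

substT-rename : ∀ x y s t → y ∉ varsT t → substT y s (substT x (var y) t) ≡ substT x s t
substT-rename x y s (var z) y∉ with x ≟ z
... | yes _ = substT-self y s
... | no _  = substT-other s (∉-head y∉)
substT-rename x y s (ctm c) y∉ = refl

map-substT-rename : ∀ x y s ts → y ∉ concatMap varsT ts →
                    map (substT y s) (map (substT x (var y)) ts) ≡ map (substT x s) ts
map-substT-rename x y s []       y∉ = refl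
map-substT-rename x y s (t ∷ ts) y∉ =
  cong₂ _∷_ (substT-rename x y s t (∉-++⁻ˡ y∉)) (map-substT-rename x y s ts (∉-++⁻ʳ (varsT t) y∉))

[≔]-rename : ∀ x y s A → y ∉ varsF A → A [ x ≔ var y ] [ y ≔ s ] ≡ A [ x ≔ s ]
[≔]-rename x y s (pr P ts) y∉ = cong (pr P) (map-substT-rename x y s ts y∉)
[≔]-rename x y s (E! t)    y∉ = cong E! (substT-rename x y s t y∉)
[≔]-rename x y s (t ≐ u)   y∉ =
  cong₂ _≐_ (substT-rename x y s t (∉-++⁻ˡ y∉)) (substT-rename x y s u (∉-++⁻ʳ (varsT t) y∉))
[≔]-rename x y s ⊥'        y∉ = refl
[≔]-rename x y s (A ∧' B)  y∉ =
  cong₂ _∧'_ ([≔]-rename x y s A (∉-++⁻ˡ y∉)) ([≔]-rename x y s B (∉-++⁻ʳ (varsF A) y∉))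
[≔]-rename x y s (A ∨' B)  y∉ =
  cong₂ _∨'_ ([≔]-rename x y s A (∉-++⁻ˡ y∉)) ([≔]-rename x y s B (∉-++⁻ʳ (varsF A) y∉))
[≔]-rename x y s (A ⇒ B)   y∉ =
  cong₂ _⇒_ ([≔]-rename x y s A (∉-++⁻ˡ y∉)) ([≔]-rename x y s B (∉-++⁻ʳ (varsF A) y∉))
[≔]-rename x y s (A ⇔ B)   y∉ =
  cong₂ _⇔_ ([≔]-rename x y s A (∉-++⁻ˡ y∉)) ([≔]-rename x y s B (∉-++⁻ʳ (varsF A) y∉))
[≔]-rename x y s (∀' z A)  y∉ with x ≟ z
... | yes _ = trans (∀-[≔]-other A s (∉-head y∉)) (cong (∀' z) ([≔]-fresh y s A (∉-tail y∉)))
... | no _  = trans (∀-[≔]-other _ s (∉-head y∉)) (cong (∀' z) ([≔]-rename x y s A (∉-tail y∉)))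
[≔]-rename x y s (∃' z A)  y∉ with x ≟ z
... | yes _ = trans (∃-[≔]-other A s (∉-head y∉)) (cong (∃' z) ([≔]-fresh y s A (∉-tail y∉)))
... | no _  = trans (∃-[≔]-other _ s (∉-head y∉)) (cong (∃' z) ([≔]-rename x y s A (∉-tail y∉)))
[≔]-rename x y s (I z A B) y∉ with x ≟ z
... | yes _ = trans (I-[≔]-other A B s (∉-head y∉))
                    (cong₂ (I z) ([≔]-fresh y s A (∉-++⁻ˡ (∉-tail y∉)))
                                 ([≔]-fresh y s B (∉-++⁻ʳ (varsF A) (∉-tail y∉))))
... | no _  = trans (I-[≔]-other _ _ s (∉-head y∉))
                    (cong₂ (I z) ([≔]-rename x y s A (∉-++⁻ˡ (∉-tail y∉)))
                                 ([≔]-rename x y s B (∉-++⁻ʳ (varsF A) (∉-tail y∉))))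

substT-absorb : ∀ x s r t → x ∉ varsT s → substT x r (substT x s t) ≡ substT x s t
substT-absorb x s r (var z) x∉ with x ≟ z
... | yes _   = substT-fresh x r s x∉
... | no x≢z  = substT-other r x≢z
substT-absorb x s r (ctm c) x∉ = refl

map-substT-absorb : ∀ x s r ts → x ∉ varsT s →
                    map (substT x r) (map (substT x s) ts) ≡ map (substT x s) ts
map-substT-absorb x s r []       x∉ = refl
map-substT-absorb x s r (t ∷ ts) x∉ = cong₂ _∷_ (substT-absorb x s r t x∉) (map-substT-absorb x s r ts x∉)

[≔]-absorb : ∀ x s r A → x ∉ varsT s → A [ x ≔ s ] [ x ≔ r ] ≡ A [ x ≔ s ]
[≔]-absorb x s r (pr P ts) x∉ = cong (pr P) (map-substT-absorb x s r ts x∉)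
[≔]-absorb x s r (E! t)    x∉ = cong E! (substT-absorb x s r t x∉)
[≔]-absorb x s r (t ≐ u)   x∉ = cong₂ _≐_ (substT-absorb x s r t x∉) (substT-absorb x s r u x∉)
[≔]-absorb x s r ⊥'        x∉ = refl
[≔]-absorb x s r (A ∧' B)  x∉ = cong₂ _∧'_ ([≔]-absorb x s r A x∉) ([≔]-absorb x s r B x∉)
[≔]-absorb x s r (A ∨' B)  x∉ = cong₂ _∨'_ ([≔]-absorb x s r A x∉) ([≔]-absorb x s r B x∉)
[≔]-absorb x s r (A ⇒ B)   x∉ = cong₂ _⇒_ ([≔]-absorb x s r A x∉) ([≔]-absorb x s r B x∉)
[≔]-absorb x s r (A ⇔ B)   x∉ = cong₂ _⇔_ ([≔]-absorb x s r A x∉) ([≔]-absorb x s r B x∉)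
[≔]-absorb x s r (∀' z A)  x∉ with x ≟ z
... | yes refl = ∀-[≔]-bound x A r
... | no x≢z   = trans (∀-[≔]-other _ r x≢z) (cong (∀' z) ([≔]-absorb x s r A x∉))
[≔]-absorb x s r (∃' z A)  x∉ with x ≟ z
... | yes refl = ∃-[≔]-bound x A r
... | no x≢z   = trans (∃-[≔]-other _ r x≢z) (cong (∃' z) ([≔]-absorb x s r A x∉))
[≔]-absorb x s r (I z A B) x∉ with x ≟ z
... | yes refl = I-[≔]-bound x A B r
... | no x≢z   = trans (I-[≔]-other _ _ r x≢z) (cong₂ (I z) ([≔]-absorb x s r A x∉) ([≔]-absorb x s r B x∉))

parsT-substT : ∀ {P : Par → Set} x s t → All P (parsT t) → All P (parsT s) → All P (parsT (substT x s t))
parsT-substT x s (var z) Pt Ps with x ≟ z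
... | yes _ = Ps
... | no _  = []
parsT-substT x s (ctm c) Pt Ps = Pt

parsT-map-substT : ∀ {P : Par → Set} x s ts → All P (concatMap parsT ts) → All P (parsT s) →
                   All P (concatMap parsT (map (substT x s) ts))
parsT-map-substT x s []       Pts Ps = []
parsT-map-substT x s (t ∷ ts) Pts Ps =
  ++⁺ (parsT-substT x s t (++⁻ˡ (parsT t) Pts) Ps) (parsT-map-substT x s ts (++⁻ʳ (parsT t) Pts) Ps)

parsF-[≔] : ∀ {P : Par → Set} x s A → All P (parsF A) → All P (parsT s) → All P (parsF (A [ x ≔ s ]))
parsF-[≔] x s (pr P ts) PA Ps = parsT-map-substT x s ts PA Ps
parsF-[≔] x s (E! t)    PA Ps = parsT-substT x s t PA Ps
parsF-[≔] x s (t ≐ u)   PA Ps =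
  ++⁺ (parsT-substT x s t (++⁻ˡ (parsT t) PA) Ps) (parsT-substT x s u (++⁻ʳ (parsT t) PA) Ps)
parsF-[≔] x s ⊥'        PA Ps = []
parsF-[≔] x s (A ∧' B)  PA Ps = ++⁺ (parsF-[≔] x s A (++⁻ˡ (parsF A) PA) Ps) (parsF-[≔] x s B (++⁻ʳ (parsF A) PA) Ps)
parsF-[≔] x s (A ∨' B)  PA Ps = ++⁺ (parsF-[≔] x s A (++⁻ˡ (parsF A) PA) Ps) (parsF-[≔] x s B (++⁻ʳ (parsF A) PA) Ps)
parsF-[≔] x s (A ⇒ B)   PA Ps = ++⁺ (parsF-[≔] x s A (++⁻ˡ (parsF A) PA) Ps) (parsF-[≔] x s B (++⁻ʳ (parsF A) PA) Ps)
parsF-[≔] x s (A ⇔ B)   PA Ps = ++⁺ (parsF-[≔] x s A (++⁻ˡ (parsF A) PA) Ps) (parsF-[≔] x s B (++⁻ʳ (parsF A) PA) Ps)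
parsF-[≔] x s (∀' z A)  PA Ps with x ≟ z
... | yes _ = PA
... | no _  = parsF-[≔] x s A PA Ps
parsF-[≔] x s (∃' z A)  PA Ps with x ≟ z
... | yes _ = PA
... | no _  = parsF-[≔] x s A PA Ps
parsF-[≔] x s (I z A B) PA Ps with x ≟ z
... | yes _ = PA
... | no _  = ++⁺ (parsF-[≔] x s A (++⁻ˡ (parsF A) PA) Ps) (parsF-[≔] x s B (++⁻ʳ (parsF A) PA) Ps)

Below : ℕ → List Par → Set
Below n = All (_< n)

Below⇒∉ : ∀ {n ps} → Below n ps → n ∉ ps
Below⇒∉ below n∈ = <-irrefl refl (All.lookup below n∈)

Below-suc : ∀ {n ps} → Below n ps → Below (suc n) ps
Below-suc = All.map m<n⇒m<1+n

Below-max : ∀ ps → Below (suc (max 0 ps)) ps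
Below-max ps = All.map s≤s (xs≤max 0 ps)

Below-par : ∀ n → Below (suc n) (parsT ⌜ par n ⌝)
Below-par n = n<1+n n ∷ []

Below-instance : ∀ {n} x A → Below n (parsF A) → Below (suc n) (parsF (A [ x ≔ ⌜ par n ⌝ ]))
Below-instance {n} x A belowA = parsF-[≔] x ⌜ par n ⌝ A (Below-suc belowA) (Below-par n)

≐-unique : ∀ {Γ x F} (s t : CTerm) → Γ ⊢ I x F (E! (var x)) → Γ ⊢ E! ⌜ s ⌝ → Γ ⊢ E! ⌜ t ⌝ →
           Γ ⊢ F [ x ≔ ⌜ s ⌝ ] → Γ ⊢ F [ x ≔ ⌜ t ⌝ ] → Γ ⊢ ⌜ s ⌝ ≐ ⌜ t ⌝
≐-unique {Γ} {x} s t ι s! t! Fs Ft =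
  subst (λ u → Γ ⊢ ⌜ s ⌝ ≐ u) (substT-self x ⌜ t ⌝)
    (IE2p {A = ⌜ s ⌝ ≐ var x} s t (at-≐ _ _) ι s! t! Fs Ft
      (subst (λ u → Γ ⊢ ⌜ s ⌝ ≐ u) (sym (substT-self x ⌜ s ⌝)) (=I s)))

∀-unique : ∀ {Γ x F} y (t : CTerm) n →
           I x F (E! (var x)) ∈ Γ → F [ x ≔ ⌜ t ⌝ ] ∈ Γ → E! ⌜ t ⌝ ∈ Γ → y ∉ varsF F →
           Below n (parsL Γ) → Below n (parsF F) → Below n (parsT ⌜ t ⌝) →
           Γ ⊢ ∀' y (F [ x ≔ var y ] ⇒ var y ≐ ⌜ t ⌝)
∀-unique {Γ} {x} {F} y t n ι∈ Ft∈ t!∈ y∉F belowΓ belowF belowt =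
  ∀I n (Below⇒∉ belowΓ) (Below⇒∉ (++⁺ (parsF-[≔] x (var y) F belowF []) belowt))
    (subst (E! d ∷ Γ ⊢_) (sym instance-eq)
      (⇒I (≐-unique (par n) t (hyp (there (there ι∈))) (hyp (there (here refl)))
                    (hyp (there (there t!∈))) (hyp (here refl)) (hyp (there (there Ft∈))))))
  where
  d : Term
  d = ⌜ par n ⌝
  instance-eq : (F [ x ≔ var y ] ⇒ var y ≐ ⌜ t ⌝) [ y ≔ d ] ≡ (F [ x ≔ d ] ⇒ d ≐ ⌜ t ⌝)
  instance-eq = cong₂ _⇒_ ([≔]-rename x y d F y∉F) (cong (_≐ ⌜ t ⌝) (substT-self y d))

russell : Var → Var → Formula → Formula → Formula
russell x y F G = ∃' x (F ∧' ∀' y (F [ x ≔ var y ] ⇒ var y ≐ var x) ∧' G)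

Below-russell : ∀ {n} x y F G → Below n (parsF F) → Below n (parsF G) → Below n (parsF (russell x y F G))
Below-russell x y F G belowF belowG = ++⁺ belowF (++⁺ (++⁺ (parsF-[≔] x (var y) F belowF []) []) belowG)

russell-witness : ∀ {Γ x F G} y (b : CTerm) n → x ≢ y → y ∉ varsF F →
                  I x F (E! (var x)) ∈ Γ → F [ x ≔ ⌜ b ⌝ ] ∈ Γ → G [ x ≔ ⌜ b ⌝ ] ∈ Γ → E! ⌜ b ⌝ ∈ Γ →
                  Below n (parsL Γ) → Below n (parsF F) → Below n (parsT ⌜ b ⌝) →
                  Γ ⊢ russell x y F G
russell-witness {Γ} {x} {F} {G} y b n x≢y y∉F ι∈ Fb∈ Gb∈ b!∈ belowΓ belowF belowb =
  ∃I b (subst (Γ ⊢_) (sym (cong (λ B → F [ x ≔ ⌜ b ⌝ ] ∧' B ∧' G [ x ≔ ⌜ b ⌝ ]) instance-eq))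
          (∧I (hyp Fb∈) (∧I (∀-unique y b n ι∈ Fb∈ b!∈ y∉F belowΓ belowF belowb) (hyp Gb∈))))
       (hyp b!∈)
  where
  open ≡-Reasoning
  x∉y : x ∉ varsT (var y)
  x∉y (here x≡y) = x≢y x≡y
  instance-eq : (∀' y (F [ x ≔ var y ] ⇒ var y ≐ var x)) [ x ≔ ⌜ b ⌝ ]
                ≡ ∀' y (F [ x ≔ var y ] ⇒ var y ≐ ⌜ b ⌝)
  instance-eq = begin
    (∀' y (F [ x ≔ var y ] ⇒ var y ≐ var x)) [ x ≔ ⌜ b ⌝ ]
      ≡⟨ ∀-[≔]-other _ ⌜ b ⌝ x≢y ⟩
    ∀' y (F [ x ≔ var y ] [ x ≔ ⌜ b ⌝ ] ⇒ substT x ⌜ b ⌝ (var y) ≐ substT x ⌜ b ⌝ (var x))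
      ≡⟨ cong (∀' y) (cong₂ _⇒_ ([≔]-absorb x (var y) ⌜ b ⌝ F x∉y)
                                (cong₂ _≐_ (substT-other ⌜ b ⌝ x≢y) (substT-self x ⌜ b ⌝))) ⟩
    ∀' y (F [ x ≔ var y ] ⇒ var y ≐ ⌜ b ⌝) ∎

-- The two subdeductions of IE1p discharge separate assumptions, so both may use the fresh parameter n.
russell-from-instance : ∀ {Γ x F G} y (a : CTerm) n → x ≢ y → y ∉ varsF F →
                        I x F G ∈ Γ → I x F (E! (var x)) ∈ Γ → F [ x ≔ ⌜ a ⌝ ] ∈ Γ → E! ⌜ a ⌝ ∈ Γ →
                        Below n (parsL Γ) → Below n (parsF F) → Below n (parsF G) → Below n (parsT ⌜ a ⌝) →
                        Γ ⊢ russell x y F G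
russell-from-instance {Γ} {x} {F} {G} y a n x≢y y∉F ιG∈ ι∈ Fa∈ a!∈ belowΓ belowF belowG belowa =
  IE1p a n n (hyp ιG∈) (hyp Fa∈) (hyp a!∈)
    (Below⇒∉ belowΓ) (Below⇒∉ belowF) (Below⇒∉ belowG) (Below⇒∉ belowR) (Below⇒∉ belowa)
    (≐-unique (par n) a (hyp (there (there ι∈))) (hyp (there (here refl))) (hyp (there (there a!∈)))
              (hyp (here refl)) (hyp (there (there Fa∈))))
    (Below⇒∉ belowΓ) (Below⇒∉ belowF) (Below⇒∉ belowG) (Below⇒∉ belowR)
    (russell-witness y (par n) (suc n) x≢y y∉F (there (there (there ι∈)))
       (here refl) (there (here refl)) (there (there (here refl)))
       belowΓ′ (Below-suc belowF) (Below-par n))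
  where
  belowR : Below n (parsF (russell x y F G))
  belowR = Below-russell x y F G belowF belowG
  b : Term
  b = ⌜ par n ⌝
  belowΓ′ : Below (suc n) (parsL (F [ x ≔ b ] ∷ G [ x ≔ b ] ∷ E! b ∷ Γ))
  belowΓ′ = ++⁺ (Below-instance x F belowF)
           (++⁺ (Below-instance x G belowG) (++⁺ (Below-par n) (Below-suc belowΓ)))

mainTheorem8 : (F G : Formula) (x y : Var) → x ≢ y → y ∉ varsF F → y ∉ varsF G →
    I x F G ∷ I x F (E! (var x)) ∷ [] ⊢
    ∃' x (F ∧' ∀' y (F [ x ≔ var y ] ⇒ var y ≐ var x) ∧' G)
mainTheorem8 F G x y x≢y y∉F _ =
  IE3p n (hyp (there (here refl))) (Below⇒∉ belowΓ) (Below⇒∉ belowF)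
       (Below⇒∉ (Below-russell x y F G belowF belowG))
    (russell-from-instance y (par n) (suc n) x≢y y∉F
       (there (there (here refl))) (there (there (there (here refl)))) (here refl) (there (here refl))
       belowΓ′ (Below-suc belowF) (Below-suc belowG) (Below-par n))
  where
  n : Par
  n = suc (max 0 (parsF F ++ parsF G))
  belowFG : Below n (parsF F ++ parsF G)
  belowFG = Below-max (parsF F ++ parsF G)
  belowF : Below n (parsF F)
  belowF = ++⁻ˡ (parsF F) belowFG
  belowG : Below n (parsF G)
  belowG = ++⁻ʳ (parsF F) belowFG
  belowΓ : Below n (parsL (I x F G ∷ I x F (E! (var x)) ∷ []))
  belowΓ = ++⁺ belowFG (++⁺ (++⁺ belowF []) [])
  belowΓ′ : Below (suc n) (parsL (F [ x ≔ ⌜ par n ⌝ ] ∷ E! ⌜ par n ⌝ ∷ I x F G ∷ I x F (E! (var x)) ∷ []))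
  belowΓ′ = ++⁺ (Below-instance x F belowF) (++⁺ (Below-par n) (Below-suc belowΓ))
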